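{- Bisimilarity is a congruence for the nondeterministic $\mathrm{SKI}_u$ calculus: if $\sim$ denotes the greatest bisimulation on $\Lambda_u^\oplus$, then for every operation symbol $f$ of arity $n$ (among $S,K,I,\circ,S',K',S'',\oplus$) and all terms with $p_i\sim q_i$ ($i=1,\dots,n$), $f(p_1,\dots,p_n)\sim f(q_1,\dots,q_n)$.
   Context: $\Lambda_u^\oplus$ is the set of closed terms generated by $\Lambda_u^\oplus::=S\mid K\mid I\mid\Lambda_u^\oplus\circ\Lambda_u^\oplus\mid S'(\Lambda_u^\oplus)\mid K'(\Lambda_u^\oplus)\mid S''(\Lambda_u^\oplus,\Lambda_u^\oplus)\mid\Lambda_u^\oplus\oplus\Lambda_u^\oplus$; write $p\,q$ for $p\circ q$. The transition relation has unlabelled transitions $p\to p'$ and labelled transitions $p\xrightarrow{t}p'$ ($t\in\Lambda_u^\oplus$), inductively generated by: $S\xrightarrow{t}S'(t)$; $S'(p)\xrightarrow{t}S''(p,t)$; $S''(p,q)\xrightarrow{t}(p\,t)\,(q\,t)$; $K\xrightarrow{t}K'(t)$; $K'(p)\xrightarrow{t}p$; $I\xrightarrow{t}t$; if $p\to p'$ then $p\,q\to p'\,q$; if $p\xrightarrow{q}p'$ then $p\,q\to p'$; $p\oplus q\to p$; $p\oplus q\to q$. A relation $R$ on $\Lambda_u^\oplus$ is a bisimulation if whenever $p\,R\,q$: every $p\to p'$ is matched by some $q\to q'$ with $p'\,R\,q'$, every $q\to q'$ by some $p\to p'$ with $p'\,R\,q'$, and for every label $t$, every $p\xrightarrow{t}p'$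 is matched by some $q\xrightarrow{t}q'$ with $p'\,R\,q'$ and every $q\xrightarrow{t}q'$ by some $p\xrightarrow{t}p'$ with $p'\,R\,q'$. -}

module Defs where

open import Data.Product using (Σ; ∃; _×_; _,_)
open import Level using (0ℓ)

data Term : Set where
  S K I : Term
  _∘_   : Term → Term → Term
  S′    : Term → Term
  K′    : Term → Term
  S″    : Term → Term → Term
  _⊕_   : Term → Term → Term

infixl 7 _∘_
infixl 5 _⊕_

mutual
  data _⟶_ : Term → Term → Set where
    app-τ : ∀ {p p′ q} → p ⟶ p′ → (p ∘ q) ⟶ (p′ ∘ q)
    app-l : ∀ {p p′ q} → Step p q p′ → (p ∘ q) ⟶ p′
    ⊕-l   : ∀ {p q} → (p ⊕ q) ⟶ p
    ⊕-r   : ∀ {p q} → (p ⊕ q) ⟶ q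

  -- labelled transitions  Step p t p'  means  p --t--> p'
  data Step : Term → Term → Term → Set where
    S-t   : ∀ {t} → Step S t (S′ t)
    S′-t  : ∀ {p t} → Step (S′ p) t (S″ p t)
    S″-t  : ∀ {p q t} → Step (S″ p q) t ((p ∘ t) ∘ (q ∘ t))
    K-t   : ∀ {t} → Step K t (K′ t)
    K′-t  : ∀ {p t} → Step (K′ p) t p
    I-t   : ∀ {t} → Step I t t

Rel : Set₁
Rel = Term → Term → Set

IsBisimulation : Rel → Set
IsBisimulation R = ∀ {p q} → R p q →
    (∀ {p′} → p ⟶ p′ → ∃ λ q′ → (q ⟶ q′) × R p′ q′)
  × (∀ {q′} → q ⟶ q′ → ∃ λ p′ → (p ⟶ p′) × R p′ q′)
  × (∀ t {p′} → Step p t p′ → ∃ λ q′ → Step q t q′ × R p′ q′)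
  × (∀ t {q′} → Step q t q′ → ∃ λ p′ → Step p t p′ × R p′ q′)

_~_ : Term → Term → Set₁
p ~ q = Σ Rel λ R → IsBisimulation R × R p q

infix 4 _~_

-- Close a bisimulation R under reflexivity, transitivity and the term constructors; the
-- result is again a bisimulation.  The labelled rules never inspect their label, they only
-- copy it into the target (S′ t, S″ p t, (p ∘ t) ∘ (q ∘ t), t), so replacing a label by a
-- related one yields a related target; transitivity then composes a step matched by R with
-- such a relabelling.  This is what makes the case p ∘ t ⟶ p′ (from Step p t p′) work.
module Submission where

open import Defs
open import Data.Empty using (⊥)
open import Data.Product using (_×_; _,_; ∃)
open import Data.Sum using (inj₁; inj₂)
open import Function.Base using (flip)
open import Relation.Binary.Core using (_⇒_)
open import Relation.Binary.Construct.Union using (_∪_)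

Progresses : Rel → Term → Term → Set
Progresses R p q =
    (∀ {p′} → p ⟶ p′ → ∃ λ q′ → (q ⟶ q′) × R p′ q′)
  × (∀ {q′} → q ⟶ q′ → ∃ λ p′ → (p ⟶ p′) × R p′ q′)
  × (∀ t {p′} → Step p t p′ → ∃ λ q′ → Step q t q′ × R p′ q′)
  × (∀ t {q′} → Step q t q′ → ∃ λ p′ → Step p t p′ × R p′ q′)

Progresses-mono : ∀ {R R′ p q} → R ⇒ R′ → Progresses R p q → Progresses R′ p q
Progresses-mono R⇒R′ (τ→ , τ← , step→ , step←) =
    (λ s → let q′ , s′ , r = τ→ s in q′ , s′ , R⇒R′ r)
  , (λ s → let p′ , s′ , r = τ← s in p′ , s′ , R⇒R′ r)
  , (λ t s → let q′ , s′ , r = step→ t s in q′ , s′ , R⇒R′ r)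
  , (λ t s → let p′ , s′ , r = step← t s in p′ , s′ , R⇒R′ r)

∅-isBisimulation : IsBisimulation (λ _ _ → ⊥)
∅-isBisimulation ()

flip-isBisimulation : ∀ {R} → IsBisimulation R → IsBisimulation (flip R)
flip-isBisimulation B r with B r
... | τ→ , τ← , step→ , step← = τ← , τ→ , step← , step→

∪-isBisimulation : ∀ {R₁ R₂} → IsBisimulation R₁ → IsBisimulation R₂ → IsBisimulation (R₁ ∪ R₂)
∪-isBisimulation B₁ B₂ (inj₁ r) = Progresses-mono inj₁ (B₁ r)
∪-isBisimulation B₁ B₂ (inj₂ r) = Progresses-mono inj₂ (B₂ r)

data Cong (R : Rel) : Rel where
  include : R ⇒ Cong R
  refl    : ∀ {p} → Cong R p p
  trans   : ∀ {p q r} → Cong R p q → Cong R q r → Cong R p r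
  ∘-cong  : ∀ {p₁ p₂ q₁ q₂} → Cong R p₁ q₁ → Cong R p₂ q₂ → Cong R (p₁ ∘ p₂) (q₁ ∘ q₂)
  S′-cong : ∀ {p q} → Cong R p q → Cong R (S′ p) (S′ q)
  K′-cong : ∀ {p q} → Cong R p q → Cong R (K′ p) (K′ q)
  S″-cong : ∀ {p₁ p₂ q₁ q₂} → Cong R p₁ q₁ → Cong R p₂ q₂ → Cong R (S″ p₁ p₂) (S″ q₁ q₂)
  ⊕-cong  : ∀ {p₁ p₂ q₁ q₂} → Cong R p₁ q₁ → Cong R p₂ q₂ → Cong R (p₁ ⊕ p₂) (q₁ ⊕ q₂)

Cong-flip : ∀ {R} → flip (Cong R) ⇒ Cong (flip R)
Cong-flip (include r)   = include r
Cong-flip refl          = refl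
Cong-flip (trans c d)   = trans (Cong-flip d) (Cong-flip c)
Cong-flip (∘-cong c d)  = ∘-cong (Cong-flip c) (Cong-flip d)
Cong-flip (S′-cong c)   = S′-cong (Cong-flip c)
Cong-flip (K′-cong c)   = K′-cong (Cong-flip c)
Cong-flip (S″-cong c d) = S″-cong (Cong-flip c) (Cong-flip d)
Cong-flip (⊕-cong c d)  = ⊕-cong (Cong-flip c) (Cong-flip d)

module _ {R : Rel} where

  Step-relabel : ∀ {p t u p′} → Cong R t u → Step p t p′ → ∃ λ p″ → Step p u p″ × Cong R p′ p″
  Step-relabel c S-t  = _ , S-t  , S′-cong c
  Step-relabel c S′-t = _ , S′-t , S″-cong refl c
  Step-relabel c S″-t = _ , S″-t , ∘-cong (∘-cong refl c) (∘-cong refl c)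
  Step-relabel c K-t  = _ , K-t  , K′-cong c
  Step-relabel c K′-t = _ , K′-t , refl
  Step-relabel c I-t  = _ , I-t  , c

  module _ (B : IsBisimulation R) where

    Cong-simulates-Step : ∀ {p q t u p′} → Cong R p q → Cong R t u → Step p t p′ →
                          ∃ λ q′ → Step q u q′ × Cong R p′ q′
    Cong-simulates-Step (include r) c s with B r
    ... | _ , _ , step→ , _ with step→ _ s
    ... | q₁ , s₁ , r₁ with Step-relabel c s₁
    ... | q₂ , s₂ , c₂ = q₂ , s₂ , trans (include r₁) c₂
    Cong-simulates-Step refl c s = Step-relabel c s
    Cong-simulates-Step (trans c₁ c₂) c s with Cong-simulates-Step c₁ c s
    ... | _ , s₁ , d₁ with Cong-simulates-Step c₂ refl s₁
    ... | q′ , s₂ , d₂ = q′ , s₂ , trans d₁ d₂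
    Cong-simulates-Step (S′-cong c₁) c S′-t = _ , S′-t , S″-cong c₁ c
    Cong-simulates-Step (K′-cong c₁) c K′-t = _ , K′-t , c₁
    Cong-simulates-Step (S″-cong c₁ c₂) c S″-t = _ , S″-t , ∘-cong (∘-cong c₁ c) (∘-cong c₂ c)

    Cong-simulates-⟶ : ∀ {p q p′} → Cong R p q → p ⟶ p′ → ∃ λ q′ → q ⟶ q′ × Cong R p′ q′
    Cong-simulates-⟶ (include r) s with B r
    ... | τ→ , _ = let q′ , s′ , r′ = τ→ s in q′ , s′ , include r′
    Cong-simulates-⟶ refl s = _ , s , refl
    Cong-simulates-⟶ (trans c₁ c₂) s with Cong-simulates-⟶ c₁ s
    ... | _ , s₁ , d₁ with Cong-simulates-⟶ c₂ s₁
    ... | q′ , s₂ , d₂ = q′ , s₂ , trans d₁ d₂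
    Cong-simulates-⟶ (∘-cong c₁ c₂) (app-τ s) with Cong-simulates-⟶ c₁ s
    ... | _ , s₁ , d = _ , app-τ s₁ , ∘-cong d c₂
    Cong-simulates-⟶ (∘-cong c₁ c₂) (app-l s) with Cong-simulates-Step c₁ c₂ s
    ... | q′ , s₁ , d = q′ , app-l s₁ , d
    Cong-simulates-⟶ (⊕-cong c₁ c₂) ⊕-l = _ , ⊕-l , c₁
    Cong-simulates-⟶ (⊕-cong c₁ c₂) ⊕-r = _ , ⊕-r , c₂

Cong-isBisimulation : ∀ {R} → IsBisimulation R → IsBisimulation (Cong R)
Cong-isBisimulation {R} B c =
    Cong-simulates-⟶ B c
  , (λ s → let p′ , s′ , d = Cong-simulates-⟶ B˘ (Cong-flip c) s in p′ , s′ , Cong-flip d)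
  , (λ t s → Cong-simulates-Step B c refl s)
  , (λ t s → let p′ , s′ , d = Cong-simulates-Step B˘ (Cong-flip c) refl s in p′ , s′ , Cong-flip d)
  where
    B˘ : IsBisimulation (flip R)
    B˘ = flip-isBisimulation B

~-refl : ∀ {p} → p ~ p
~-refl = Cong (λ _ _ → ⊥) , Cong-isBisimulation ∅-isBisimulation , refl

~-cong₁ : {f : Term → Term} → (∀ {R p q} → Cong R p q → Cong R (f p) (f q)) →
          ∀ {p q} → p ~ q → f p ~ f q
~-cong₁ f-cong (R , B , r) = Cong R , Cong-isBisimulation B , f-cong (include r)

~-cong₂ : {f : Term → Term → Term} →
          (∀ {R p₁ p₂ q₁ q₂} → Cong R p₁ q₁ → Cong R p₂ q₂ → Cong R (f p₁ p₂) (f q₁ q₂)) →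
          ∀ {p₁ p₂ q₁ q₂} → p₁ ~ q₁ → p₂ ~ q₂ → f p₁ p₂ ~ f q₁ q₂
~-cong₂ f-cong (R₁ , B₁ , r₁) (R₂ , B₂ , r₂) =
  Cong (R₁ ∪ R₂) , Cong-isBisimulation (∪-isBisimulation B₁ B₂) ,
  f-cong (include (inj₁ r₁)) (include (inj₂ r₂))

proposition3p8 :
    (S ~ S) × (K ~ K) × (I ~ I)
    × (∀ {p₁ p₂ q₁ q₂} → p₁ ~ q₁ → p₂ ~ q₂ → (p₁ ∘ p₂) ~ (q₁ ∘ q₂))
    × (∀ {p q} → p ~ q → S′ p ~ S′ q)
    × (∀ {p q} → p ~ q → K′ p ~ K′ q)
    × (∀ {p₁ p₂ q₁ q₂} → p₁ ~ q₁ → p₂ ~ q₂ → S″ p₁ p₂ ~ S″ q₁ q₂)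
    × (∀ {p₁ p₂ q₁ q₂} → p₁ ~ q₁ → p₂ ~ q₂ → (p₁ ⊕ p₂) ~ (q₁ ⊕ q₂))
proposition3p8 =
    ~-refl , ~-refl , ~-refl
  , ~-cong₂ ∘-cong , ~-cong₁ S′-cong , ~-cong₁ K′-cong , ~-cong₂ S″-cong , ~-cong₂ ⊕-cong
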